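{- For every $n\ge1$, the average number of ascents of $\mathrm{Flatten}(\pi)$, taken over all $\pi\in\mathcal S_n$, equals $\frac{(n-1)(n+2)}{2n}$.
   Context: $\mathcal S_n$ is the set of permutations of $[n]$. For $\pi\in\mathcal S_n$ written in standard cycle form (each cycle begins with its smallest element, cycles ordered left to right by increasing smallest elements), $\mathrm{Flatten}(\pi)$ is the word obtained by erasing the parentheses. An ascent of a word $w_1\cdots w_n$ is an index $i$ with $w_i<w_{i+1}$. -}

module Defs where

open import Data.Nat using (ℕ; zero; suc; _+_; _<?_)
open import Data.Fin using (Fin; toℕ; _≟_)
open import Data.Fin.Permutation using (Permutation′; _⟨$⟩ʳ_)
open import Data.List using (List; []; _∷_; _++_; allFin; foldl; map)
open import Data.Nat.ListAction using (sum)
open import Data.List.Relation.Unary.Any using (any?)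
open import Data.List.Relation.Unary.Any using (Any)
open import Data.List.Relation.Unary.AllPairs using (AllPairs)
open import Data.Product using (_×_; _,_; proj₁; proj₂)
open import Relation.Binary.PropositionalEquality using (_≡_)
open import Relation.Nullary using (¬_; yes; no)

walk : ∀ {n} → Permutation′ n → Fin n → ℕ → Fin n → List (Fin n)
walk π a zero x = []
walk π a (suc k) x with x ≟ a
... | yes _ = []
... | no _ = x ∷ walk π a k (π ⟨$⟩ʳ x)

-- The cycle of π containing a, written starting with a:  (a, π a, π² a, …).
-- A cycle has length at most n, so fuel n suffices.
cycleOf : ∀ {n} → Permutation′ n → Fin n → List (Fin n)
cycleOf {n} π a = a ∷ walk π a n (π ⟨$⟩ʳ a)

-- Flatten(π): scan the elements in increasing order; each element not yet
-- seen is the smallest element of a new cycle, which is written out starting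
-- from it.  This yields the standard cycle form with parentheses erased.
flattenStep : ∀ {n} → Permutation′ n → List (Fin n) → Fin n → List (Fin n)
flattenStep π w i with any? (i ≟_) w
... | yes _ = w
... | no _ = w ++ cycleOf π i

flatten : ∀ {n} → Permutation′ n → List (Fin n)
flatten {n} π = foldl (flattenStep π) [] (allFin n)

ascentAt : ∀ {n} → Fin n → Fin n → ℕ
ascentAt x y with toℕ x <? toℕ y
... | yes _ = 1
... | no _ = 0

ascents : ∀ {n} → List (Fin n) → ℕ
ascents [] = 0
ascents (x ∷ []) = 0
ascents (x ∷ y ∷ w) = ascentAt x y + ascents (y ∷ w)

_≈ₚ_ : ∀ {n} → Permutation′ n → Permutation′ n → Set
σ ≈ₚ τ = ∀ i → σ ⟨$⟩ʳ i ≡ τ ⟨$⟩ʳ i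

EnumeratesSn : ∀ n → List (Permutation′ n) → Set
EnumeratesSn n L = (∀ π → Any (λ σ → σ ≈ₚ π) L) × AllPairs (λ σ τ → ¬ (σ ≈ₚ τ)) L

totalAscents : ∀ {n} → List (Permutation′ n) → ℕ
totalAscents L = sum (map (λ π → ascents (flatten π)) L)

module Submission where

-- Let T(n) be the total number of ascents of Flatten(π) over π ∈ S_n. Inserting the new largest
-- letter n+1 right after c in the cycle of c, or as a new fixed point, is a bijection
-- S_n × [n+1] → S_{n+1}. On Flatten(π) it inserts n+1 right after the letter c, resp. appends it:
-- this creates the ascent c < n+1 and turns the step leaving c into a descent from n+1. Over the
-- n+1 choices of c every ascent of Flatten(π) is lost exactly once, so the insertions into π carry
-- n·asc(Flatten π) + n + 1 ascents in total. Hence T(n+1) = n·T(n) + (n+1)·n!, and the closed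
-- form follows by induction. A sum over S_n does not depend on the chosen enumeration, so it may
-- be computed along the one generated by insertion.

open import Defs
open import Data.Nat as ℕ using (ℕ; zero; suc; _+_; _*_; _!; _≥_; _∸_; s≤s)
open import Data.Nat.Properties
  using (+-0-commutativeMonoid; +-identityʳ; +-suc; +-comm; +-assoc; +-cancelʳ-≡; *-comm; *-zeroʳ;
         <-asym; ≤-trans; ≤-pred; ≤-reflexive; m≤n+m; n<1+n; m≤n⇒∃[o]m+o≡n)
open import Data.Nat.ListAction using (sum)
open import Data.Nat.ListAction.Properties using (sum-++; sum-↭)
open import Data.Nat.Tactic.RingSolver using (solve-∀)
open import Data.Bool using (if_then_else_)
open import Data.Fin using (Fin; zero; suc; toℕ; fromℕ; inject₁; punchIn; _≟_; _<_)
open import Data.Fin.Properties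
  using (inject₁-injective; fromℕ≢inject₁; toℕ-inject₁; toℕ-fromℕ; toℕ<n; pigeonhole)
open import Data.Fin.Permutation
  using (Permutation′; _⟨$⟩ʳ_; _⟨$⟩ˡ_; inverseʳ; id; insert; remove; transpose; _∘ₚ_;
         insert-punchIn; insert-remove)
import Data.Fin.Permutation.Components as PC
open import Data.List
  using (List; []; _∷_; _++_; [_]; map; foldl; allFin; tabulate; length; cartesianProductWith)
open import Data.List.Properties
  using (foldl-cong; foldl-++; map-++; map-∘; map-cong; map-tabulate; length-++; length-map; length-tabulate)
open import Data.List.Membership.Propositional using (_∈_; _∉_)
open import Data.List.Membership.Propositional.Properties
  using (∈-allFin; ∈-++⁺ˡ; ∈-++⁺ʳ; ∈-map⁺; ∈-map⁻)
open import Data.List.Membership.Propositional.Properties.WithK using (unique∧set⇒bag)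
open import Data.List.Relation.Binary.BagAndSetEquality using (∼bag⇒↭)
import Data.List.Relation.Binary.Permutation.Propositional.Properties as ↭
open import Data.List.Relation.Unary.All using (All; []; _∷_; universal)
import Data.List.Relation.Unary.All.Properties as All
open import Data.List.Relation.Unary.Any using (Any; here; there; any?)
import Data.List.Relation.Unary.Any as Any
import Data.List.Relation.Unary.Any.Properties as Any
open import Data.List.Relation.Unary.AllPairs using ([]; _∷_)
open import Data.List.Relation.Unary.Unique.Setoid using (Unique)
import Data.List.Relation.Unary.Unique.Setoid.Properties as Unique
open import Data.List.Relation.Unary.Unique.Propositional.Properties using (allFin⁺)
import Data.Vec as Vec
open import Data.Vec.Properties using (lookup∘tabulate; tabulate-cong)
open import Data.Product using (∃-syntax; _×_; _,_; proj₁; proj₂)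
open import Data.Sum using (_⊎_; inj₁; inj₂)
open import Function using (_∘_; case_of_)
open import Function.Bundles using (Injection; mk⇔)
open import Function.Properties.Inverse using (↔⇒↣)
open import Level using (0ℓ)
open import Relation.Binary.Bundles using (Setoid)
open import Relation.Binary.PropositionalEquality hiding ([_])
open import Relation.Nullary using (yes; no; does)
open import Relation.Nullary.Decidable using (dec-true; dec-false; dec-yes)
open import Relation.Nullary.Negation using (contradiction)
open import Algebra.Properties.CommutativeMonoid.Sum +-0-commutativeMonoid
  using (sum-syntax; ∑-distrib-+; sum-cong-≗; sum-replicate-zero)

top : ∀ {n} → Fin (suc n)
top {n} = fromℕ n

data TopView {n : ℕ} : Fin (suc n) → Set where
  inject : (y : Fin n) → TopView (inject₁ y)
  isTop  : TopView top

topView : ∀ {n} (x : Fin (suc n)) → TopView x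
topView {zero} zero = isTop
topView {suc n} zero = inject zero
topView {suc n} (suc x) with topView x
... | inject y = inject (suc y)
... | isTop = isTop

inject₁≢top : ∀ {n} {y : Fin n} → inject₁ y ≢ top
inject₁≢top e = fromℕ≢inject₁ (sym e)

punchIn-top : ∀ {n} (y : Fin n) → punchIn top y ≡ inject₁ y
punchIn-top zero = refl
punchIn-top (suc y) = cong suc (punchIn-top y)

inject₁<top : ∀ {n} (x : Fin n) → inject₁ x < top {n}
inject₁<top {n} x rewrite toℕ-inject₁ x | toℕ-fromℕ n = toℕ<n x

map-inject₁<top : ∀ {n} (w : List (Fin n)) → All (_< top {n}) (map inject₁ w)
map-inject₁<top {n} w = All.map⁺ {P = _< top {n}} (universal inject₁<top w)

∈-map-inject₁⁻ : ∀ {n} {x : Fin n} {w} → inject₁ x ∈ map inject₁ w → x ∈ w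
∈-map-inject₁⁻ ιx∈ with ∈-map⁻ inject₁ ιx∈
... | y , y∈w , ιx≡ιy = subst (_∈ _) (sym (inject₁-injective ιx≡ιy)) y∈w

top∉map-inject₁ : ∀ {n} (w : List (Fin n)) → top ∉ map inject₁ w
top∉map-inject₁ w top∈ with ∈-map⁻ inject₁ top∈
... | y , _ , top≡ιy = inject₁≢top (sym top≡ιy)

allFin-∷ʳ : ∀ n → allFin (suc n) ≡ map inject₁ (allFin n) ++ [ top ]
allFin-∷ʳ n = trans (tabulate-∷ʳ n (λ i → i)) (cong (_++ [ top ]) (sym (map-tabulate (λ i → i) inject₁)))
  where
    tabulate-∷ʳ : ∀ {A : Set} n (f : Fin (suc n) → A) → tabulate f ≡ tabulate (f ∘ inject₁) ++ [ f top ]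
    tabulate-∷ʳ zero f = refl
    tabulate-∷ʳ (suc n) f = cong (f zero ∷_) (tabulate-∷ʳ n (f ∘ suc))

-- Words: occurrences, insertion after a letter, ascents

count : ∀ {m} → Fin m → List (Fin m) → ℕ
count x [] = 0
count x (y ∷ w) with y ≟ x
... | yes _ = suc (count x w)
... | no _ = count x w

EachOnce : ∀ {m} → List (Fin m) → Set
EachOnce w = ∀ x → count x w ≡ 1

count-++ : ∀ {m} (x : Fin m) u v → count x (u ++ v) ≡ count x u + count x v
count-++ x [] v = refl
count-++ x (y ∷ u) v with y ≟ x
... | yes _ = cong suc (count-++ x u v)
... | no _ = count-++ x u v

count-∷-cong : ∀ {m} {x : Fin m} y {w w′} → count x w ≡ count x w′ → count x (y ∷ w) ≡ count x (y ∷ w′)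
count-∷-cong {x = x} y e with y ≟ x
... | yes _ = cong suc e
... | no _ = e

count-∷-≡ : ∀ {m} {x : Fin m} w → count x (x ∷ w) ≡ suc (count x w)
count-∷-≡ {x = x} w with x ≟ x
... | yes _ = refl
... | no x≢x = contradiction refl x≢x

count-∷-≢ : ∀ {m} {x y : Fin m} w → y ≢ x → count x (y ∷ w) ≡ count x w
count-∷-≢ {x = x} {y} w y≢x with y ≟ x
... | yes y≡x = contradiction y≡x y≢x
... | no _ = refl

count-∉ : ∀ {m} {x : Fin m} {u} → x ∉ u → count x u ≡ 0
count-∉ {x = x} {[]} x∉u = refl
count-∉ {x = x} {y ∷ u} x∉u with y ≟ x
... | yes y≡x = contradiction (here (sym y≡x)) x∉u
... | no _ = count-∉ (x∉u ∘ there)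

insertAfterEach : ∀ {m} → Fin m → Fin m → List (Fin m) → List (Fin m)
insertAfterEach c t [] = []
insertAfterEach c t (x ∷ u) with x ≟ c
... | yes _ = x ∷ t ∷ insertAfterEach c t u
... | no _ = x ∷ insertAfterEach c t u

module _ {m} (c t : Fin m) where

  insertAfterEach-++ : ∀ u v → insertAfterEach c t (u ++ v) ≡ insertAfterEach c t u ++ insertAfterEach c t v
  insertAfterEach-++ [] v = refl
  insertAfterEach-++ (x ∷ u) v with x ≟ c
  ... | yes _ = cong (λ w → x ∷ t ∷ w) (insertAfterEach-++ u v)
  ... | no _ = cong (x ∷_) (insertAfterEach-++ u v)

  insertAfterEach-here : ∀ {x u} → x ≡ c → insertAfterEach c t (x ∷ u) ≡ x ∷ t ∷ insertAfterEach c t u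
  insertAfterEach-here {x} x≡c with x ≟ c
  ... | yes _ = refl
  ... | no x≢c = contradiction x≡c x≢c

  insertAfterEach-there : ∀ {x u} → x ≢ c → insertAfterEach c t (x ∷ u) ≡ x ∷ insertAfterEach c t u
  insertAfterEach-there {x} x≢c with x ≟ c
  ... | yes x≡c = contradiction x≡c x≢c
  ... | no _ = refl

  insertAfterEach-∉ : ∀ {u} → c ∉ u → insertAfterEach c t u ≡ u
  insertAfterEach-∉ {[]} c∉u = refl
  insertAfterEach-∉ {x ∷ u} c∉u with x ≟ c
  ... | yes x≡c = contradiction (here (sym x≡c)) c∉u
  ... | no _ = cong (x ∷_) (insertAfterEach-∉ (c∉u ∘ there))

  ∈-insertAfterEach⁺ : ∀ {x u} → x ∈ u → x ∈ insertAfterEach c t u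
  ∈-insertAfterEach⁺ {u = y ∷ u} x∈u with y ≟ c | x∈u
  ... | yes _ | here x≡y = here x≡y
  ... | yes _ | there x∈u′ = there (there (∈-insertAfterEach⁺ x∈u′))
  ... | no _ | here x≡y = here x≡y
  ... | no _ | there x∈u′ = there (∈-insertAfterEach⁺ x∈u′)

  ∈-insertAfterEach⁻ : ∀ {x u} → x ≢ t → x ∈ insertAfterEach c t u → x ∈ u
  ∈-insertAfterEach⁻ {u = y ∷ u} x≢t x∈ with y ≟ c | x∈
  ... | yes _ | here x≡y = here x≡y
  ... | yes _ | there (here x≡t) = contradiction x≡t x≢t
  ... | yes _ | there (there x∈′) = there (∈-insertAfterEach⁻ x≢t x∈′)
  ... | no _ | here x≡y = here x≡y
  ... | no _ | there x∈′ = there (∈-insertAfterEach⁻ x≢t x∈′)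

  inserted-∈ : ∀ {u} → c ∈ u → t ∈ insertAfterEach c t u
  inserted-∈ {y ∷ u} c∈u with y ≟ c | c∈u
  ... | yes _ | _ = there (here refl)
  ... | no y≢c | here c≡y = contradiction (sym c≡y) y≢c
  ... | no _ | there c∈u′ = there (inserted-∈ c∈u′)

  count-insertAfterEach : ∀ {x} u → x ≢ t → count x (insertAfterEach c t u) ≡ count x u
  count-insertAfterEach [] x≢t = refl
  count-insertAfterEach (y ∷ u) x≢t with y ≟ c
  ... | yes _ = count-∷-cong y (trans (count-∷-≢ _ (x≢t ∘ sym)) (count-insertAfterEach u x≢t))
  ... | no _ = count-∷-cong y (count-insertAfterEach u x≢t)

  count-inserted : ∀ u → count t (insertAfterEach c t u) ≡ count t u + count c u
  count-t∷ : ∀ u → count t (t ∷ insertAfterEach c t u) ≡ count t u + suc (count c u)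

  count-inserted [] = refl
  count-inserted (y ∷ u) with y ≟ c
  ... | yes _ with y ≟ t
  ...   | yes _ = cong suc (count-t∷ u)
  ...   | no _ = count-t∷ u
  count-inserted (y ∷ u) | no _ with y ≟ t
  ...   | yes _ = cong suc (count-inserted u)
  ...   | no _ = count-inserted u

  count-t∷ u = begin
    count t (t ∷ insertAfterEach c t u)  ≡⟨ count-∷-≡ (insertAfterEach c t u) ⟩
    suc (count t (insertAfterEach c t u)) ≡⟨ cong suc (count-inserted u) ⟩
    suc (count t u + count c u)           ≡⟨ +-suc (count t u) (count c u) ⟨
    count t u + suc (count c u)           ∎
    where open ≡-Reasoning

headAscent : ∀ {m} → Fin m → List (Fin m) → ℕ
headAscent x [] = 0
headAscent x (y ∷ _) = ascentAt x y

ascents-∷ : ∀ {m} (x : Fin m) w → ascents (x ∷ w) ≡ headAscent x w + ascents w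
ascents-∷ x [] = refl
ascents-∷ x (y ∷ w) = refl

ascentsAfter : ∀ {m} → Fin m → List (Fin m) → ℕ
ascentsAfter c [] = 0
ascentsAfter c (x ∷ w) = (if does (x ≟ c) then headAscent x w else 0) + ascentsAfter c w

ascentAt-< : ∀ {m} {x y : Fin m} → x < y → ascentAt x y ≡ 1
ascentAt-< {x = x} {y} x<y with toℕ x ℕ.<? toℕ y
... | yes _ = refl
... | no x≮y = contradiction x<y x≮y

ascentAt-> : ∀ {m} {x y : Fin m} → y < x → ascentAt x y ≡ 0
ascentAt-> {x = x} {y} y<x with toℕ x ℕ.<? toℕ y
... | yes x<y = contradiction x<y (<-asym y<x)
... | no _ = refl

headAscent-below : ∀ {m} {t : Fin m} {w} → All (_< t) w → headAscent t w ≡ 0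
headAscent-below [] = refl
headAscent-below (y<t ∷ _) = ascentAt-> y<t

ascentsAfter-∉ : ∀ {m} {c : Fin m} {u} → c ∉ u → ascentsAfter c u ≡ 0
ascentsAfter-∉ {c = c} {[]} c∉u = refl
ascentsAfter-∉ {c = c} {x ∷ w} c∉u with x ≟ c
... | yes x≡c = contradiction (here (sym x≡c)) c∉u
... | no _ = ascentsAfter-∉ (c∉u ∘ there)

∑-indicator : ∀ {m} (x : Fin m) k → ∑[ c < m ] (if does (x ≟ c) then k else 0) ≡ k
∑-indicator {suc m} zero k = trans (cong (k +_) (sum-replicate-zero m)) (+-identityʳ k)
∑-indicator {suc m} (suc x) k = ∑-indicator x k

∑-ascentsAfter : ∀ {m} (u : List (Fin m)) → ∑[ c < m ] ascentsAfter c u ≡ ascents u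
∑-ascentsAfter {m} [] = sum-replicate-zero m
∑-ascentsAfter {m} (x ∷ w) = begin
    ∑[ c < m ] ((if does (x ≟ c) then headAscent x w else 0) + ascentsAfter c w)
  ≡⟨ ∑-distrib-+ (λ c → if does (x ≟ c) then headAscent x w else 0) (λ c → ascentsAfter c w) ⟩
    ∑[ c < m ] (if does (x ≟ c) then headAscent x w else 0) + ∑[ c < m ] ascentsAfter c w
  ≡⟨ cong₂ _+_ (∑-indicator x (headAscent x w)) (∑-ascentsAfter w) ⟩
    headAscent x w + ascents w
  ≡⟨ ascents-∷ x w ⟨
    ascents (x ∷ w) ∎
  where open ≡-Reasoning

module _ {m} (c t : Fin m) where

  headAscent-insertAfterEach : ∀ x w → headAscent x (insertAfterEach c t w) ≡ headAscent x w
  headAscent-insertAfterEach x [] = refl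
  headAscent-insertAfterEach x (y ∷ w) with y ≟ c
  ... | yes _ = refl
  ... | no _ = refl

  -- Inserting the large letter t after an occurrence of c creates an ascent into t and
  -- replaces the step out of c by a descent out of t.
  ascents-insertAfterEach : ∀ u → All (_< t) u →
    ascents (insertAfterEach c t u) + ascentsAfter c u ≡ ascents u + count c u
  ascents-insertAfterEach [] _ = refl
  ascents-insertAfterEach (x ∷ w) (x<t ∷ w<t) with x ≟ c
  ... | yes _ = begin
      ascentAt x t + ascents (t ∷ insertAfterEach c t w) + (headAscent x w + ascentsAfter c w)
    ≡⟨ cong₂ (λ a b → a + b + (headAscent x w + ascentsAfter c w)) (ascentAt-< x<t) ascents-t∷ ⟩
      1 + ascents (insertAfterEach c t w) + (headAscent x w + ascentsAfter c w)
    ≡⟨ shuffle (ascents (insertAfterEach c t w)) (headAscent x w) (ascentsAfter c w) ⟩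
      headAscent x w + (ascents (insertAfterEach c t w) + ascentsAfter c w) + 1
    ≡⟨ cong (λ z → headAscent x w + z + 1) (ascents-insertAfterEach w w<t) ⟩
      headAscent x w + (ascents w + count c w) + 1
    ≡⟨ shuffle′ (headAscent x w) (ascents w) (count c w) ⟩
      (headAscent x w + ascents w) + suc (count c w)
    ≡⟨ cong (_+ suc (count c w)) (ascents-∷ x w) ⟨
      ascents (x ∷ w) + suc (count c w) ∎
    where
      open ≡-Reasoning
      ascents-t∷ : ascents (t ∷ insertAfterEach c t w) ≡ ascents (insertAfterEach c t w)
      ascents-t∷ = trans (ascents-∷ t (insertAfterEach c t w)) (cong (_+ ascents (insertAfterEach c t w)) (trans (headAscent-insertAfterEach t w) (headAscent-below w<t)))
      shuffle : ∀ a h b → 1 + a + (h + b) ≡ h + (a + b) + 1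
      shuffle = solve-∀
      shuffle′ : ∀ h a k → h + (a + k) + 1 ≡ h + a + suc k
      shuffle′ = solve-∀
  ... | no _ = begin
      ascents (x ∷ insertAfterEach c t w) + ascentsAfter c w
    ≡⟨ cong (_+ ascentsAfter c w) (trans (ascents-∷ x (insertAfterEach c t w)) (cong (_+ ascents (insertAfterEach c t w)) (headAscent-insertAfterEach x w))) ⟩
      headAscent x w + ascents (insertAfterEach c t w) + ascentsAfter c w
    ≡⟨ +-assoc (headAscent x w) _ _ ⟩
      headAscent x w + (ascents (insertAfterEach c t w) + ascentsAfter c w)
    ≡⟨ cong (headAscent x w +_) (ascents-insertAfterEach w w<t) ⟩
      headAscent x w + (ascents w + count c w)
    ≡⟨ +-assoc (headAscent x w) (ascents w) (count c w) ⟨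
      headAscent x w + ascents w + count c w
    ≡⟨ cong (_+ count c w) (ascents-∷ x w) ⟨
      ascents (x ∷ w) + count c w ∎
    where open ≡-Reasoning

ascents-∷ʳ : ∀ {m} {t x : Fin m} u → x ∈ u → All (_< t) u → ascents (u ++ [ t ]) ≡ ascents u + 1
ascents-∷ʳ (y ∷ []) _ (y<t ∷ []) = cong (_+ 0) (ascentAt-< y<t)
ascents-∷ʳ (y ∷ z ∷ w) _ (_ ∷ z∷w<t) =
  trans (cong (ascentAt y z +_) (ascents-∷ʳ (z ∷ w) (here refl) z∷w<t)) (sym (+-assoc (ascentAt y z) _ 1))

count-map-inject₁ : ∀ {n} (x : Fin n) w → count (inject₁ x) (map inject₁ w) ≡ count x w
count-map-inject₁ x [] = refl
count-map-inject₁ x (y ∷ w) with inject₁ y ≟ inject₁ x | y ≟ x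
... | yes _ | yes _ = cong suc (count-map-inject₁ x w)
... | no _ | no _ = count-map-inject₁ x w
... | yes ιy≡ιx | no y≢x = contradiction (inject₁-injective ιy≡ιx) y≢x
... | no ιy≢ιx | yes y≡x = contradiction (cong inject₁ y≡x) ιy≢ιx

ascentAt-inject₁ : ∀ {n} (x y : Fin n) → ascentAt (inject₁ x) (inject₁ y) ≡ ascentAt x y
ascentAt-inject₁ x y with toℕ (inject₁ x) ℕ.<? toℕ (inject₁ y) | toℕ x ℕ.<? toℕ y
... | yes _ | yes _ = refl
... | no _ | no _ = refl
... | yes ιx<ιy | no x≮y = contradiction (subst₂ ℕ._<_ (toℕ-inject₁ x) (toℕ-inject₁ y) ιx<ιy) x≮y
... | no ιx≮ιy | yes x<y = contradiction (subst₂ ℕ._<_ (sym (toℕ-inject₁ x)) (sym (toℕ-inject₁ y)) x<y) ιx≮ιy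

ascents-map-inject₁ : ∀ {n} (w : List (Fin n)) → ascents (map inject₁ w) ≡ ascents w
ascents-map-inject₁ [] = refl
ascents-map-inject₁ (x ∷ []) = refl
ascents-map-inject₁ (x ∷ y ∷ w) = cong₂ _+_ (ascentAt-inject₁ x y) (ascents-map-inject₁ (y ∷ w))

insertTopAfter : ∀ {n} → Fin (suc n) → List (Fin n) → List (Fin (suc n))
insertTopAfter c w = insertAfterEach c top (map inject₁ w)

insertTopAfter-++ : ∀ {n} (c : Fin (suc n)) u v → insertTopAfter c (u ++ v) ≡ insertTopAfter c u ++ insertTopAfter c v
insertTopAfter-++ c u v = trans (cong (insertAfterEach c top) (map-++ inject₁ u v)) (insertAfterEach-++ c top (map inject₁ u) (map inject₁ v))

∈-insertTopAfter⁻ : ∀ {n} {c : Fin (suc n)} {i w} → inject₁ i ∈ insertTopAfter c w → i ∈ w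
∈-insertTopAfter⁻ {c = c} = ∈-map-inject₁⁻ ∘ ∈-insertAfterEach⁻ c top inject₁≢top


-- Inserting top into a cycle

⟨$⟩ʳ-injective : ∀ {n} (π : Permutation′ n) {x y} → π ⟨$⟩ʳ x ≡ π ⟨$⟩ʳ y → x ≡ y
⟨$⟩ʳ-injective π = Injection.injective (↔⇒↣ π)

transpose-left : ∀ {n} (i j : Fin n) → PC.transpose i j i ≡ j
transpose-left i j rewrite dec-true (i ≟ i) refl = refl

transpose-right : ∀ {n} (i j : Fin n) → PC.transpose i j j ≡ i
transpose-right i j with j ≟ i
... | yes j≡i = j≡i
... | no _ rewrite dec-true (j ≟ j) refl = refl

transpose-other : ∀ {n} {i j k : Fin n} → k ≢ i → k ≢ j → PC.transpose i j k ≡ k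
transpose-other {i = i} {j} {k} k≢i k≢j rewrite dec-false (k ≟ i) k≢i | dec-false (k ≟ j) k≢j = refl

extend : ∀ {n} → Permutation′ n → Permutation′ (suc n)
extend = insert top top

module _ {n} (π : Permutation′ n) where

  extend-top : extend π ⟨$⟩ʳ top ≡ top
  extend-top rewrite proj₂ (dec-yes (top {n} ≟ top) refl) = refl

  extend-inject₁ : ∀ y → extend π ⟨$⟩ʳ inject₁ y ≡ inject₁ (π ⟨$⟩ʳ y)
  extend-inject₁ y = begin
    extend π ⟨$⟩ʳ inject₁ y    ≡⟨ cong (extend π ⟨$⟩ʳ_) (punchIn-top y) ⟨
    extend π ⟨$⟩ʳ punchIn top y ≡⟨ insert-punchIn top top π y ⟩
    punchIn top (π ⟨$⟩ʳ y)      ≡⟨ punchIn-top (π ⟨$⟩ʳ y) ⟩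
    inject₁ (π ⟨$⟩ʳ y)          ∎
    where open ≡-Reasoning

extend-cong : ∀ {n} {π ρ : Permutation′ n} → π ≈ₚ ρ → extend π ≈ₚ extend ρ
extend-cong {π = π} {ρ} π≈ρ x with topView x
... | inject y = trans (extend-inject₁ π y) (trans (cong inject₁ (π≈ρ y)) (sym (extend-inject₁ ρ y)))
... | isTop = trans (extend-top π) (sym (extend-top ρ))

-- Writing top = n+1, the cycle of insertAfter π c through c is that of π with n+1 placed right after c;
-- for c = n+1 it is π with the new fixed point n+1.
insertAfter : ∀ {n} → Permutation′ n → Fin (suc n) → Permutation′ (suc n)
insertAfter π c = transpose c top ∘ₚ extend π

module _ {n} (π : Permutation′ n) where

  insertAfter-at : ∀ c → insertAfter π c ⟨$⟩ʳ c ≡ top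
  insertAfter-at c rewrite transpose-left c top = extend-top π

  insertAfter-top : ∀ {y c} → inject₁ y ≡ c → insertAfter π c ⟨$⟩ʳ top ≡ inject₁ (π ⟨$⟩ʳ y)
  insertAfter-top {y} refl rewrite transpose-right (inject₁ y) top = extend-inject₁ π y

  insertAfter-top-top : insertAfter π top ⟨$⟩ʳ top ≡ top
  insertAfter-top-top rewrite transpose-left (top {n}) top = extend-top π

  insertAfter-inject₁ : ∀ {y c} → inject₁ y ≢ c → insertAfter π c ⟨$⟩ʳ inject₁ y ≡ inject₁ (π ⟨$⟩ʳ y)
  insertAfter-inject₁ {y} y≢c rewrite transpose-other y≢c inject₁≢top = extend-inject₁ π y

insertAfter-cong : ∀ {n} {π ρ : Permutation′ n} c → π ≈ₚ ρ → insertAfter π c ≈ₚ insertAfter ρ c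
insertAfter-cong c π≈ρ x = extend-cong π≈ρ (PC.transpose c top x)

insertAfter-injective : ∀ {n} {π ρ : Permutation′ n} {c d} →
  insertAfter π c ≈ₚ insertAfter ρ d → π ≈ₚ ρ × c ≡ d
insertAfter-injective {π = π} {ρ} {c} {d} e = π≈ρ , c≡d
  where
    c≡d : c ≡ d
    c≡d = ⟨$⟩ʳ-injective (insertAfter ρ d) (trans (sym (e c)) (trans (insertAfter-at π c) (sym (insertAfter-at ρ d))))

    -- transposing back turns insertAfter π c into extend π
    π≈ρ : π ≈ₚ ρ
    π≈ρ y = inject₁-injective (begin
      inject₁ (π ⟨$⟩ʳ y)                        ≡⟨ extend-inject₁ π y ⟨
      extend π ⟨$⟩ʳ inject₁ y                    ≡⟨ cong (extend π ⟨$⟩ʳ_) (PC.transpose-inverse c top) ⟨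
      insertAfter π c ⟨$⟩ʳ PC.transpose top c (inject₁ y) ≡⟨ e (PC.transpose top c (inject₁ y)) ⟩
      insertAfter ρ d ⟨$⟩ʳ PC.transpose top c (inject₁ y) ≡⟨ cong (λ d → insertAfter ρ d ⟨$⟩ʳ PC.transpose top c (inject₁ y)) c≡d ⟨
      extend ρ ⟨$⟩ʳ PC.transpose c top (PC.transpose top c (inject₁ y)) ≡⟨ cong (extend ρ ⟨$⟩ʳ_) (PC.transpose-inverse c top) ⟩
      extend ρ ⟨$⟩ʳ inject₁ y                    ≡⟨ extend-inject₁ ρ y ⟩
      inject₁ (ρ ⟨$⟩ʳ y)                        ∎)
      where open ≡-Reasoning

-- Transposing top with its preimage c makes top a fixed point of σ, which is then removed.
module _ {n} (σ : Permutation′ (suc n)) where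

  private
    c : Fin (suc n)
    c = σ ⟨$⟩ˡ top

    τ : Permutation′ (suc n)
    τ = transpose top c ∘ₚ σ

    τ-top : τ ⟨$⟩ʳ top ≡ top
    τ-top rewrite transpose-left (top {n}) c = inverseʳ σ

  deleteTop : Permutation′ n
  deleteTop = remove top τ

  insertAfter-deleteTop : insertAfter deleteTop (σ ⟨$⟩ˡ top) ≈ₚ σ
  insertAfter-deleteTop x = begin
    insert top top deleteTop ⟨$⟩ʳ PC.transpose c top x           ≡⟨ cong (λ t → insert top t deleteTop ⟨$⟩ʳ PC.transpose c top x) τ-top ⟨
    insert top (τ ⟨$⟩ʳ top) deleteTop ⟨$⟩ʳ PC.transpose c top x ≡⟨ insert-remove top τ (PC.transpose c top x) ⟩
    σ ⟨$⟩ʳ PC.transpose top c (PC.transpose c top x)            ≡⟨ cong (σ ⟨$⟩ʳ_) (PC.transpose-inverse top c) ⟩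
    σ ⟨$⟩ʳ x                                                   ∎
    where open ≡-Reasoning

-- Cycles and Flatten

module _ {n} (π : Permutation′ n) where

  walk-start : ∀ a k → walk π a (suc k) a ≡ []
  walk-start a k with a ≟ a
  ... | yes _ = refl
  ... | no a≢a = contradiction refl a≢a

  walk-step : ∀ {a x} k → x ≢ a → walk π a (suc k) x ≡ x ∷ walk π a k (π ⟨$⟩ʳ x)
  walk-step {a} {x} k x≢a with x ≟ a
  ... | yes x≡a = contradiction x≡a x≢a
  ... | no _ = refl

module _ {n} {π ρ : Permutation′ n} (π≈ρ : π ≈ₚ ρ) where

  walk-cong : ∀ a k x → walk π a k x ≡ walk ρ a k x
  walk-cong a zero x = refl
  walk-cong a (suc k) x with x ≟ a
  ... | yes _ = refl
  ... | no _ rewrite π≈ρ x = cong (x ∷_) (walk-cong a k (ρ ⟨$⟩ʳ x))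

  flatten-cong : flatten π ≡ flatten ρ
  flatten-cong = foldl-cong step-cong [] (allFin n)
    where
      step-cong : ∀ w i → flattenStep π w i ≡ flattenStep ρ w i
      step-cong w i with any? (i ≟_) w
      ... | yes _ = refl
      ... | no _ rewrite π≈ρ i = cong (λ z → w ++ i ∷ z) (walk-cong i n (ρ ⟨$⟩ʳ i))

iterate : ∀ {A : Set} → (A → A) → ℕ → A → A
iterate f zero x = x
iterate f (suc k) x = iterate f k (f x)

iterate-+ : ∀ {A : Set} (f : A → A) p q x → iterate f (p + q) x ≡ iterate f q (iterate f p x)
iterate-+ f zero q x = refl
iterate-+ f (suc p) q x = iterate-+ f p q (f x)

module _ {n} (π : Permutation′ n) where

  data Reaches (a : Fin n) : ℕ → Fin n → Set where
    here  : ∀ {k x} → x ≡ a → Reaches a (suc k) x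
    there : ∀ {k x} → x ≢ a → Reaches a k (π ⟨$⟩ʳ x) → Reaches a (suc k) x

  walk-+ : ∀ {a k x} → Reaches a k x → ∀ j → walk π a (k + j) x ≡ walk π a k x
  walk-+ {a} {x = x} (here x≡a) j with x ≟ a
  ... | yes _ = refl
  ... | no x≢a = contradiction x≡a x≢a
  walk-+ {a} {x = x} (there x≢a r) j with x ≟ a
  ... | yes x≡a = contradiction x≡a x≢a
  ... | no _ = cong (x ∷_) (walk-+ r j)

  walk-fuel-irrelevant : ∀ {a k k′ x} → Reaches a k x → Reaches a k′ x → walk π a k x ≡ walk π a k′ x
  walk-fuel-irrelevant {a} {k} {k′} {x} r r′ = begin
    walk π a k x          ≡⟨ walk-+ r k′ ⟨
    walk π a (k + k′) x   ≡⟨ cong (λ l → walk π a l x) (+-comm k k′) ⟩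
    walk π a (k′ + k) x   ≡⟨ walk-+ r′ k ⟩
    walk π a k′ x         ∎
    where open ≡-Reasoning

  reaches-iterate : ∀ {a} j k x → j ℕ.< k → iterate (π ⟨$⟩ʳ_) j x ≡ a → Reaches a k x
  reaches-iterate zero (suc k) x _ x≡a = here x≡a
  reaches-iterate {a} (suc j) (suc k) x (s≤s j<k) e with x ≟ a
  ... | yes x≡a = here x≡a
  ... | no x≢a = there x≢a (reaches-iterate j k (π ⟨$⟩ʳ x) j<k e)

  iterate-injective : ∀ p {x y} → iterate (π ⟨$⟩ʳ_) p x ≡ iterate (π ⟨$⟩ʳ_) p y → x ≡ y
  iterate-injective zero e = e
  iterate-injective (suc p) e = ⟨$⟩ʳ-injective π (iterate-injective p e)

  -- By pigeonhole two of a, π a, …, πⁿ a coincide; cancelling the common prefix returns to a.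
  orbit-closes : ∀ a → ∃[ k ] k ℕ.< n × iterate (π ⟨$⟩ʳ_) (suc k) a ≡ a
  orbit-closes a with pigeonhole (n<1+n n) (λ i → iterate (π ⟨$⟩ʳ_) (toℕ i) a)
  ... | i , j , i<j , πⁱa≡πʲa with m≤n⇒∃[o]m+o≡n i<j
  ...   | k , i+1+k≡j = k , k<n , iterate-injective (toℕ i) (begin
      iterate f (toℕ i) (iterate f (suc k) a)  ≡⟨ iterate-+ f (suc k) (toℕ i) a ⟨
      iterate f (suc k + toℕ i) a              ≡⟨ cong (λ l → iterate f l a) k+1+i≡j ⟩
      iterate f (toℕ j) a                      ≡⟨ πⁱa≡πʲa ⟨
      iterate f (toℕ i) a                      ∎)
    where
      open ≡-Reasoning
      f = π ⟨$⟩ʳ_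
      k+1+i≡j : suc k + toℕ i ≡ toℕ j
      k+1+i≡j = trans (cong suc (+-comm k (toℕ i))) i+1+k≡j
      k<n : k ℕ.< n
      k<n = ≤-trans (s≤s (m≤n+m k (toℕ i))) (≤-trans (≤-reflexive i+1+k≡j) (≤-pred (toℕ<n j)))

  walk-returns : ∀ a → Reaches a n (π ⟨$⟩ʳ a)
  walk-returns a with orbit-closes a
  ... | k , k<n , πᵏ⁺¹a≡a = reaches-iterate k n (π ⟨$⟩ʳ a) k<n πᵏ⁺¹a≡a

  walk-avoids-start : ∀ a k x → count a (walk π a k x) ≡ 0
  walk-avoids-start a zero x = refl
  walk-avoids-start a (suc k) x with x ≟ a
  ... | yes _ = refl
  ... | no x≢a = trans (count-∷-≢ _ x≢a) (walk-avoids-start a k (π ⟨$⟩ʳ x))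

  ∈-flattenStep⁺ : ∀ {i} w j → i ∈ w → i ∈ flattenStep π w j
  ∈-flattenStep⁺ w j i∈w with any? (j ≟_) w
  ... | yes _ = i∈w
  ... | no _ = ∈-++⁺ˡ i∈w

  ∈-flattenStep : ∀ w j → j ∈ flattenStep π w j
  ∈-flattenStep w j with any? (j ≟_) w
  ... | yes j∈w = j∈w
  ... | no _ = ∈-++⁺ʳ w (here refl)

  ∈-foldl-flattenStep : ∀ {i} w js → i ∈ w ⊎ i ∈ js → i ∈ foldl (flattenStep π) w js
  ∈-foldl-flattenStep w [] (inj₁ i∈w) = i∈w
  ∈-foldl-flattenStep w (j ∷ js) (inj₁ i∈w) = ∈-foldl-flattenStep (flattenStep π w j) js (inj₁ (∈-flattenStep⁺ w j i∈w))
  ∈-foldl-flattenStep w (j ∷ js) (inj₂ (here refl)) = ∈-foldl-flattenStep (flattenStep π w j) js (inj₁ (∈-flattenStep w j))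
  ∈-foldl-flattenStep w (j ∷ js) (inj₂ (there i∈js)) = ∈-foldl-flattenStep (flattenStep π w j) js (inj₂ i∈js)

  ∈-flatten : ∀ i → i ∈ flatten π
  ∈-flatten i = ∈-foldl-flattenStep [] (allFin n) (inj₂ (∈-allFin i))

-- Flatten after an insertion

module _ {n} (π : Permutation′ n) (c : Fin (suc n)) where

  private
    π′ : Permutation′ (suc n)
    π′ = insertAfter π c

    π′-at : ∀ {x} → inject₁ x ≡ c → π′ ⟨$⟩ʳ inject₁ x ≡ top
    π′-at ιx≡c = trans (cong (π′ ⟨$⟩ʳ_) ιx≡c) (insertAfter-at π c)

  walk-insertAfter : ∀ a k x →
    walk π′ (inject₁ a) (k + count c (map inject₁ (walk π a k x))) (inject₁ x) ≡ insertTopAfter c (walk π a k x)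
  walk-insertAfter a zero x = refl
  walk-insertAfter a (suc k) x with x ≟ a
  ... | yes refl = walk-start π′ (inject₁ x) (k + 0)
  ... | no x≢a with inject₁ x ≟ c
  ...   | yes ιx≡c = begin
      walk π′ (inject₁ a) (suc k + suc m) (inject₁ x)            ≡⟨ cong (λ l → walk π′ (inject₁ a) (suc l) (inject₁ x)) (+-suc k m) ⟩
      walk π′ (inject₁ a) (suc (suc (k + m))) (inject₁ x)        ≡⟨ walk-step π′ (suc (k + m)) (x≢a ∘ inject₁-injective) ⟩
      inject₁ x ∷ walk π′ (inject₁ a) (suc (k + m)) (π′ ⟨$⟩ʳ inject₁ x)
        ≡⟨ cong (λ y → inject₁ x ∷ walk π′ (inject₁ a) (suc (k + m)) y) (π′-at ιx≡c) ⟩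
      inject₁ x ∷ walk π′ (inject₁ a) (suc (k + m)) top          ≡⟨ cong (inject₁ x ∷_) (walk-step π′ (k + m) (inject₁≢top ∘ sym)) ⟩
      inject₁ x ∷ top ∷ walk π′ (inject₁ a) (k + m) (π′ ⟨$⟩ʳ top)
        ≡⟨ cong (λ y → inject₁ x ∷ top ∷ walk π′ (inject₁ a) (k + m) y) (insertAfter-top π ιx≡c) ⟩
      inject₁ x ∷ top ∷ walk π′ (inject₁ a) (k + m) (inject₁ (π ⟨$⟩ʳ x))
        ≡⟨ cong (λ w → inject₁ x ∷ top ∷ w) (walk-insertAfter a k (π ⟨$⟩ʳ x)) ⟩
      inject₁ x ∷ top ∷ insertTopAfter c (walk π a k (π ⟨$⟩ʳ x))             ∎
    where
      open ≡-Reasoning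
      m = count c (map inject₁ (walk π a k (π ⟨$⟩ʳ x)))
  ...   | no ιx≢c = begin
      walk π′ (inject₁ a) (suc (k + m)) (inject₁ x)              ≡⟨ walk-step π′ (k + m) (x≢a ∘ inject₁-injective) ⟩
      inject₁ x ∷ walk π′ (inject₁ a) (k + m) (π′ ⟨$⟩ʳ inject₁ x)
        ≡⟨ cong (λ y → inject₁ x ∷ walk π′ (inject₁ a) (k + m) y) (insertAfter-inject₁ π ιx≢c) ⟩
      inject₁ x ∷ walk π′ (inject₁ a) (k + m) (inject₁ (π ⟨$⟩ʳ x)) ≡⟨ cong (inject₁ x ∷_) (walk-insertAfter a k (π ⟨$⟩ʳ x)) ⟩
      inject₁ x ∷ insertTopAfter c (walk π a k (π ⟨$⟩ʳ x))                   ∎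
    where
      open ≡-Reasoning
      m = count c (map inject₁ (walk π a k (π ⟨$⟩ʳ x)))

  reaches-insertAfter : ∀ {a k x} → Reaches π a k x →
    Reaches π′ (inject₁ a) (k + count c (map inject₁ (walk π a k x))) (inject₁ x)
  reaches-insertAfter {a} {suc k} (here refl) rewrite walk-start π a k = here refl
  reaches-insertAfter {a} {suc k} {x} (there x≢a r) rewrite walk-step π k x≢a with inject₁ x ≟ c
  ... | yes ιx≡c rewrite +-suc k (count c (map inject₁ (walk π a k (π ⟨$⟩ʳ x)))) =
    there (x≢a ∘ inject₁-injective) (subst (Reaches π′ (inject₁ a) _) (sym (π′-at ιx≡c))
      (there (inject₁≢top ∘ sym) (subst (Reaches π′ (inject₁ a) _) (sym (insertAfter-top π ιx≡c))
        (reaches-insertAfter r))))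
  ... | no ιx≢c =
    there (x≢a ∘ inject₁-injective) (subst (Reaches π′ (inject₁ a) _) (sym (insertAfter-inject₁ π ιx≢c))
      (reaches-insertAfter r))

  cycleOf-insertAfter : ∀ i → cycleOf π′ (inject₁ i) ≡ insertTopAfter c (cycleOf π i)
  cycleOf-insertAfter i = case inject₁ i ≟ c of λ where
      (yes ιi≡c) → trans (cong (inject₁ i ∷_) (walk-via-top ιi≡c)) (sym (insertAfterEach-here c top ιi≡c))
      (no ιi≢c) → trans (cong (inject₁ i ∷_) (walk-past ιi≢c)) (sym (insertAfterEach-there c top ιi≢c))
    where
      open ≡-Reasoning
      m = count c (map inject₁ (walk π i n (π ⟨$⟩ʳ i)))

      walk-via-top : inject₁ i ≡ c → walk π′ (inject₁ i) (suc n) (π′ ⟨$⟩ʳ inject₁ i) ≡ top ∷ insertTopAfter c (walk π i n (π ⟨$⟩ʳ i))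
      walk-via-top ιi≡c = begin
        walk π′ (inject₁ i) (suc n) (π′ ⟨$⟩ʳ inject₁ i)       ≡⟨ cong (walk π′ (inject₁ i) (suc n)) (π′-at ιi≡c) ⟩
        walk π′ (inject₁ i) (suc n) top                        ≡⟨ walk-step π′ n (inject₁≢top ∘ sym) ⟩
        top ∷ walk π′ (inject₁ i) n (π′ ⟨$⟩ʳ top)             ≡⟨ cong (λ y → top ∷ walk π′ (inject₁ i) n y) (insertAfter-top π ιi≡c) ⟩
        top ∷ walk π′ (inject₁ i) n (inject₁ (π ⟨$⟩ʳ i))      ≡⟨ cong (λ l → top ∷ walk π′ (inject₁ i) l (inject₁ (π ⟨$⟩ʳ i))) n≡n+m ⟩
        top ∷ walk π′ (inject₁ i) (n + m) (inject₁ (π ⟨$⟩ʳ i)) ≡⟨ cong (top ∷_) (walk-insertAfter i n (π ⟨$⟩ʳ i)) ⟩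
        top ∷ insertTopAfter c (walk π i n (π ⟨$⟩ʳ i))                     ∎
        where
          m≡0 : m ≡ 0
          m≡0 = begin
            count c (map inject₁ (walk π i n (π ⟨$⟩ʳ i)))           ≡⟨ cong (λ d → count d (map inject₁ (walk π i n (π ⟨$⟩ʳ i)))) ιi≡c ⟨
            count (inject₁ i) (map inject₁ (walk π i n (π ⟨$⟩ʳ i))) ≡⟨ count-map-inject₁ i (walk π i n (π ⟨$⟩ʳ i)) ⟩
            count i (walk π i n (π ⟨$⟩ʳ i))                         ≡⟨ walk-avoids-start π i n (π ⟨$⟩ʳ i) ⟩
            0                                                       ∎
          n≡n+m : n ≡ n + m
          n≡n+m = trans (sym (+-identityʳ n)) (cong (n +_) (sym m≡0))

      -- the orbit of inject₁ i under π′ closes within suc n steps, so the extra fuel is irrelevant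
      walk-past : inject₁ i ≢ c → walk π′ (inject₁ i) (suc n) (π′ ⟨$⟩ʳ inject₁ i) ≡ insertTopAfter c (walk π i n (π ⟨$⟩ʳ i))
      walk-past ιi≢c = begin
        walk π′ (inject₁ i) (suc n) (π′ ⟨$⟩ʳ inject₁ i)       ≡⟨ cong (walk π′ (inject₁ i) (suc n)) (insertAfter-inject₁ π ιi≢c) ⟩
        walk π′ (inject₁ i) (suc n) (inject₁ (π ⟨$⟩ʳ i))      ≡⟨ walk-fuel-irrelevant π′ returns returns′ ⟩
        walk π′ (inject₁ i) (n + m) (inject₁ (π ⟨$⟩ʳ i))      ≡⟨ walk-insertAfter i n (π ⟨$⟩ʳ i) ⟩
        insertTopAfter c (walk π i n (π ⟨$⟩ʳ i))                           ∎
        where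
          returns : Reaches π′ (inject₁ i) (suc n) (inject₁ (π ⟨$⟩ʳ i))
          returns = subst (Reaches π′ (inject₁ i) (suc n)) (insertAfter-inject₁ π ιi≢c) (walk-returns π′ (inject₁ i))
          returns′ : Reaches π′ (inject₁ i) (n + m) (inject₁ (π ⟨$⟩ʳ i))
          returns′ = reaches-insertAfter (walk-returns π i)

  flattenStep-insertAfter : ∀ W i → flattenStep π′ (insertTopAfter c W) (inject₁ i) ≡ insertTopAfter c (flattenStep π W i)
  flattenStep-insertAfter W i with any? (inject₁ i ≟_) (insertTopAfter c W) | any? (i ≟_) W
  ... | yes _ | yes _ = refl
  ... | yes ιi∈ | no i∉W = contradiction (∈-insertTopAfter⁻ ιi∈) i∉W
  ... | no ιi∉ | yes i∈W = contradiction (∈-insertAfterEach⁺ c top (∈-map⁺ inject₁ i∈W)) ιi∉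
  ... | no _ | no _ = trans (cong (insertTopAfter c W ++_) (cycleOf-insertAfter i)) (sym (insertTopAfter-++ c W (cycleOf π i)))

  foldl-insertAfter : ∀ is W → foldl (flattenStep π′) (insertTopAfter c W) (map inject₁ is) ≡ insertTopAfter c (foldl (flattenStep π) W is)
  foldl-insertAfter [] W = refl
  foldl-insertAfter (i ∷ is) W rewrite flattenStep-insertAfter W i = foldl-insertAfter is (flattenStep π W i)

  flatten-insertAfter-lastStep : flatten π′ ≡ flattenStep π′ (insertTopAfter c (flatten π)) top
  flatten-insertAfter-lastStep = begin
    foldl (flattenStep π′) [] (allFin (suc n))                              ≡⟨ cong (foldl (flattenStep π′) []) (allFin-∷ʳ n) ⟩
    foldl (flattenStep π′) [] (map inject₁ (allFin n) ++ [ top ])           ≡⟨ foldl-++ (flattenStep π′) [] (map inject₁ (allFin n)) [ top ] ⟩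
    flattenStep π′ (foldl (flattenStep π′) [] (map inject₁ (allFin n))) top ≡⟨ cong (λ w → flattenStep π′ w top) (foldl-insertAfter (allFin n) []) ⟩
    flattenStep π′ (insertTopAfter c (flatten π)) top                                   ∎
    where open ≡-Reasoning

flatten-insertAfter-inject₁ : ∀ {n} (π : Permutation′ n) c →
  flatten (insertAfter π (inject₁ c)) ≡ insertTopAfter (inject₁ c) (flatten π)
flatten-insertAfter-inject₁ π c rewrite flatten-insertAfter-lastStep π (inject₁ c)
  with any? (top ≟_) (insertAfterEach (inject₁ c) top (map inject₁ (flatten π)))
... | yes _ = refl
... | no top∉ = contradiction (inserted-∈ (inject₁ c) top (∈-map⁺ inject₁ (∈-flatten π c))) top∉

flatten-insertAfter-top : ∀ {n} (π : Permutation′ n) → flatten (insertAfter π top) ≡ map inject₁ (flatten π) ++ [ top ]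
flatten-insertAfter-top π
  rewrite flatten-insertAfter-lastStep π top | insertAfterEach-∉ top top (top∉map-inject₁ (flatten π))
  with any? (top ≟_) (map inject₁ (flatten π))
... | yes top∈ = contradiction top∈ (top∉map-inject₁ (flatten π))
... | no _ rewrite insertAfter-top-top π = cong (map inject₁ (flatten π) ++_) (cong (top ∷_) (walk-start (insertAfter π top) top _))

-- Ascents summed over all insertions

eachOnce-insertAfter : ∀ {n} (π : Permutation′ n) → EachOnce (flatten π) → ∀ c → EachOnce (flatten (insertAfter π c))
eachOnce-insertAfter {n} π once c with topView c
... | inject c′ rewrite flatten-insertAfter-inject₁ π c′ = λ x → go x (topView x)
  where
    w = flatten π
    go : ∀ x → TopView x → count x (insertAfterEach (inject₁ c′) top (map inject₁ w)) ≡ 1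
    go _ (inject x) = begin
      count (inject₁ x) (insertAfterEach (inject₁ c′) top (map inject₁ w)) ≡⟨ count-insertAfterEach (inject₁ c′) top (map inject₁ w) inject₁≢top ⟩
      count (inject₁ x) (map inject₁ w)                                    ≡⟨ count-map-inject₁ x w ⟩
      count x w                                                            ≡⟨ once x ⟩
      1                                                                    ∎
      where open ≡-Reasoning
    go _ isTop = begin
      count top (insertAfterEach (inject₁ c′) top (map inject₁ w))         ≡⟨ count-inserted (inject₁ c′) top (map inject₁ w) ⟩
      count top (map inject₁ w) + count (inject₁ c′) (map inject₁ w)       ≡⟨ cong₂ _+_ (count-∉ (top∉map-inject₁ w)) (count-map-inject₁ c′ w) ⟩
      count c′ w                                                           ≡⟨ once c′ ⟩
      1                                                                    ∎
      where open ≡-Reasoning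
... | isTop rewrite flatten-insertAfter-top π = λ x → go x (topView x)
  where
    w = flatten π
    go : ∀ x → TopView x → count x (map inject₁ w ++ [ top {n} ]) ≡ 1
    go _ (inject x) = begin
      count (inject₁ x) (map inject₁ w ++ [ top ])                         ≡⟨ count-++ (inject₁ x) (map inject₁ w) [ top ] ⟩
      count (inject₁ x) (map inject₁ w) + count (inject₁ x) [ top ]        ≡⟨ cong₂ _+_ (count-map-inject₁ x w) (count-∷-≢ {y = top {n}} [] (inject₁≢top ∘ sym)) ⟩
      count x w + 0                                                        ≡⟨ trans (+-identityʳ _) (once x) ⟩
      1                                                                    ∎
      where open ≡-Reasoning
    go _ isTop = begin
      count (top {n}) (map inject₁ w ++ [ top ])                           ≡⟨ count-++ top (map inject₁ w) [ top ] ⟩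
      count (top {n}) (map inject₁ w) + count top [ top {n} ]              ≡⟨ cong₂ _+_ (count-∉ (top∉map-inject₁ w)) (count-∷-≡ {x = top {n}} []) ⟩
      1                                                                    ∎
      where open ≡-Reasoning

-- Every permutation arises by insertAfter from one on fewer letters.
flatten-eachOnce : ∀ {n} (π : Permutation′ n) → EachOnce (flatten π)
flatten-eachOnce {zero} π ()
flatten-eachOnce {suc n} π =
  subst EachOnce (flatten-cong (insertAfter-deleteTop π))
    (eachOnce-insertAfter (deleteTop π) (flatten-eachOnce (deleteTop π)) (π ⟨$⟩ˡ top))

ascents-flatten-insertAfter : ∀ {n} (π : Permutation′ (suc n)) c →
  ascents (flatten (insertAfter π c)) + ascentsAfter c (map inject₁ (flatten π)) ≡ ascents (flatten π) + 1
ascents-flatten-insertAfter π c with topView c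
... | inject c′ rewrite flatten-insertAfter-inject₁ π c′ = begin
    ascents (insertAfterEach (inject₁ c′) top u) + ascentsAfter (inject₁ c′) u ≡⟨ ascents-insertAfterEach (inject₁ c′) top u (map-inject₁<top w) ⟩
    ascents u + count (inject₁ c′) u                                          ≡⟨ cong₂ _+_ (ascents-map-inject₁ w) (trans (count-map-inject₁ c′ w) (flatten-eachOnce π c′)) ⟩
    ascents w + 1                                                             ∎
  where
    open ≡-Reasoning
    w = flatten π
    u = map inject₁ w
... | isTop rewrite flatten-insertAfter-top π = begin
    ascents (u ++ [ top ]) + ascentsAfter top u ≡⟨ cong₂ _+_ (ascents-∷ʳ u (∈-map⁺ inject₁ (∈-flatten π zero)) (map-inject₁<top w)) (ascentsAfter-∉ (top∉map-inject₁ w)) ⟩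
    ascents u + 1 + 0                           ≡⟨ +-identityʳ _ ⟩
    ascents u + 1                               ≡⟨ cong (_+ 1) (ascents-map-inject₁ w) ⟩
    ascents w + 1                               ∎
  where
    open ≡-Reasoning
    w = flatten π
    u = map inject₁ w

∑-const : ∀ m k → ∑[ i < m ] k ≡ m * k
∑-const zero k = refl
∑-const (suc m) k = cong (k +_) (∑-const m k)

∑-ascents-insertAfter : ∀ {n} (π : Permutation′ (suc n)) →
  ∑[ c < suc (suc n) ] ascents (flatten (insertAfter π c)) ≡ suc n * ascents (flatten π) + suc (suc n)
∑-ascents-insertAfter {n} π = +-cancelʳ-≡ (ascents (flatten π)) _ _ (begin
    S + A                                                  ≡⟨ cong (S +_) (trans (∑-ascentsAfter u) (ascents-map-inject₁ w)) ⟨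
    S + ∑[ c < suc (suc n) ] ascentsAfter c u              ≡⟨ ∑-distrib-+ (λ c → ascents (flatten (insertAfter π c))) (λ c → ascentsAfter c u) ⟨
    ∑[ c < suc (suc n) ] (ascents (flatten (insertAfter π c)) + ascentsAfter c u)
                                                           ≡⟨ sum-cong-≗ (ascents-flatten-insertAfter π) ⟩
    ∑[ c < suc (suc n) ] (A + 1)                           ≡⟨ ∑-const (suc (suc n)) (A + 1) ⟩
    suc (suc n) * (A + 1)                                  ≡⟨ expand n A ⟩
    suc n * A + suc (suc n) + A                            ∎)
  where
    open ≡-Reasoning
    w = flatten π
    u = map inject₁ w
    A = ascents w
    S = ∑[ c < suc (suc n) ] ascents (flatten (insertAfter π c))
    expand : ∀ n a → suc (suc n) * (a + 1) ≡ suc n * a + suc (suc n) + a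
    expand = solve-∀

-- Enumerations of S_n

≈ₚ-setoid : ℕ → Setoid 0ℓ 0ℓ
≈ₚ-setoid n = record
  { Carrier = Permutation′ n
  ; _≈_ = _≈ₚ_
  ; isEquivalence = record
    { refl = λ _ → refl
    ; sym = λ π≈ρ i → sym (π≈ρ i)
    ; trans = λ π≈ρ ρ≈σ i → trans (π≈ρ i) (ρ≈σ i)
    }
  }

-- Tagged with their value tables, two enumerations become duplicate-free lists with the same
-- elements, hence permutations of each other as lists.
module _ {n} (f : Permutation′ n → ℕ) (f-cong : ∀ {π ρ} → π ≈ₚ ρ → f π ≡ f ρ) where

  private
    tagged : Permutation′ n → Vec.Vec (Fin n) n × ℕ
    tagged π = Vec.tabulate (π ⟨$⟩ʳ_) , f π

    tagged-cong : ∀ {π ρ} → π ≈ₚ ρ → tagged π ≡ tagged ρ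
    tagged-cong π≈ρ = cong₂ _,_ (tabulate-cong π≈ρ) (f-cong π≈ρ)

    tagged-injective : ∀ {π ρ} → tagged π ≡ tagged ρ → π ≈ₚ ρ
    tagged-injective {π} {ρ} e i =
      trans (sym (lookup∘tabulate (π ⟨$⟩ʳ_) i)) (trans (cong (λ t → Vec.lookup (proj₁ t) i) e) (lookup∘tabulate (ρ ⟨$⟩ʳ_) i))

    covered : ∀ {L P} → (∀ π → Any (_≈ₚ π) P) → ∀ {t} → t ∈ map tagged L → t ∈ map tagged P
    covered P-complete t∈ with ∈-map⁻ tagged t∈
    ... | π , _ , refl = Any.map⁺ (Any.map (λ ρ≈π → sym (tagged-cong ρ≈π)) (P-complete π))

  sum-enumerations : ∀ {L P} → EnumeratesSn n L → EnumeratesSn n P → sum (map f L) ≡ sum (map f P)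
  sum-enumerations {L} {P} (L-complete , L-unique) (P-complete , P-unique) = begin
    sum (map f L)                    ≡⟨ cong sum (map-∘ L) ⟩
    sum (map proj₂ (map tagged L))   ≡⟨ sum-↭ (↭.map⁺ proj₂ (∼bag⇒↭ (unique∧set⇒bag (unique L-unique) (unique P-unique)
                                          (mk⇔ (covered P-complete) (covered L-complete))))) ⟩
    sum (map proj₂ (map tagged P))   ≡⟨ cong sum (map-∘ P) ⟨
    sum (map f P)                    ∎
    where
      open ≡-Reasoning
      unique = Unique.map⁺ (≈ₚ-setoid n) (setoid _) tagged-injective

permutations : ∀ n → List (Permutation′ n)
permutations zero = [ id ]
permutations (suc n) = cartesianProductWith insertAfter (permutations n) (allFin (suc n))

permutations-enumerates : ∀ n → EnumeratesSn n (permutations n)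
permutations-enumerates n = complete n , unique n
  where
    complete : ∀ n π → Any (_≈ₚ π) (permutations n)
    complete zero π = here (λ ())
    complete (suc n) π = Any.cartesianProductWith⁺ insertAfter reinsert
      (complete n (deleteTop π)) (Any.map sym (∈-allFin (π ⟨$⟩ˡ top)))
      where
        reinsert : ∀ {ρ c} → ρ ≈ₚ deleteTop π → c ≡ π ⟨$⟩ˡ top → insertAfter ρ c ≈ₚ π
        reinsert ρ≈ refl x = trans (insertAfter-cong _ ρ≈ x) (insertAfter-deleteTop π x)

    unique : ∀ n → Unique (≈ₚ-setoid n) (permutations n)
    unique zero = [] ∷ []
    unique (suc n) = Unique.cartesianProductWith⁺ (≈ₚ-setoid n) (setoid (Fin (suc n))) (≈ₚ-setoid (suc n))
      insertAfter insertAfter-injective (unique n) (allFin⁺ (suc n))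

length-cartesianProductWith : ∀ {A B C : Set} (f : A → B → C) xs ys →
  length (cartesianProductWith f xs ys) ≡ length xs * length ys
length-cartesianProductWith f [] ys = refl
length-cartesianProductWith f (x ∷ xs) ys = begin
  length (map (f x) ys ++ cartesianProductWith f xs ys)            ≡⟨ length-++ (map (f x) ys) ⟩
  length (map (f x) ys) + length (cartesianProductWith f xs ys)    ≡⟨ cong₂ _+_ (length-map (f x) ys) (length-cartesianProductWith f xs ys) ⟩
  length ys + length xs * length ys                                ∎
  where open ≡-Reasoning

length-permutations : ∀ n → length (permutations n) ≡ n !
length-permutations zero = refl
length-permutations (suc n) = begin
  length (cartesianProductWith insertAfter (permutations n) (allFin (suc n))) ≡⟨ length-cartesianProductWith insertAfter (permutations n) (allFin (suc n)) ⟩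
  length (permutations n) * length (allFin (suc n))                            ≡⟨ cong₂ _*_ (length-permutations n) (length-tabulate (λ (c : Fin (suc n)) → c)) ⟩
  n ! * suc n                                                                  ≡⟨ *-comm (n !) (suc n) ⟩
  suc n !                                                                      ∎
  where open ≡-Reasoning

sum-map-cartesianProductWith : ∀ {A B C : Set} (h : C → ℕ) (f : A → B → C) xs ys →
  sum (map h (cartesianProductWith f xs ys)) ≡ sum (map (λ x → sum (map (h ∘ f x) ys)) xs)
sum-map-cartesianProductWith h f [] ys = refl
sum-map-cartesianProductWith h f (x ∷ xs) ys = begin
  sum (map h (map (f x) ys ++ cartesianProductWith f xs ys))                ≡⟨ cong sum (map-++ h (map (f x) ys) _) ⟩
  sum (map h (map (f x) ys) ++ map h (cartesianProductWith f xs ys))        ≡⟨ sum-++ (map h (map (f x) ys)) _ ⟩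
  sum (map h (map (f x) ys)) + sum (map h (cartesianProductWith f xs ys))   ≡⟨ cong₂ _+_ (cong sum (sym (map-∘ ys))) (sum-map-cartesianProductWith h f xs ys) ⟩
  sum (map (h ∘ f x) ys) + sum (map (λ x → sum (map (h ∘ f x) ys)) xs)      ∎
  where open ≡-Reasoning

sum-map-allFin : ∀ {n} (h : Fin n → ℕ) → sum (map h (allFin n)) ≡ ∑[ i < n ] h i
sum-map-allFin h = trans (cong sum (map-tabulate (λ i → i) h)) (sum-tabulate h)
  where
    sum-tabulate : ∀ {n} (h : Fin n → ℕ) → sum (tabulate h) ≡ ∑[ i < n ] h i
    sum-tabulate {zero} h = refl
    sum-tabulate {suc n} h = cong (h zero +_) (sum-tabulate (h ∘ suc))

sum-map-affine : ∀ {A : Set} (k d : ℕ) (f : A → ℕ) xs →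
  sum (map (λ x → k * f x + d) xs) ≡ k * sum (map f xs) + length xs * d
sum-map-affine k d f [] = sym (cong (_+ 0) (*-zeroʳ k))
sum-map-affine k d f (x ∷ xs) = trans (cong (k * f x + d +_) (sum-map-affine k d f xs))
  (regroup k (f x) (sum (map f xs)) d (length xs))
  where
    regroup : ∀ k a s d l → k * a + d + (k * s + l * d) ≡ k * (a + s) + (d + l * d)
    regroup = solve-∀

totalAscents-recurrence : ∀ n →
  totalAscents (permutations (suc (suc n))) ≡ suc n * totalAscents (permutations (suc n)) + suc (suc n) * suc n !
totalAscents-recurrence n = begin
  sum (map F (cartesianProductWith insertAfter Sₙ (allFin (suc (suc n)))))       ≡⟨ sum-map-cartesianProductWith F insertAfter Sₙ _ ⟩
  sum (map (λ π → sum (map (F ∘ insertAfter π) (allFin (suc (suc n))))) Sₙ)     ≡⟨ cong sum (map-cong per-π Sₙ) ⟩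
  sum (map (λ π → suc n * F π + suc (suc n)) Sₙ)                                 ≡⟨ sum-map-affine (suc n) (suc (suc n)) F Sₙ ⟩
  suc n * totalAscents Sₙ + length Sₙ * suc (suc n)                              ≡⟨ cong (λ l → suc n * totalAscents Sₙ + l) count-term ⟩
  suc n * totalAscents Sₙ + suc (suc n) * suc n !                                ∎
  where
    open ≡-Reasoning
    F : ∀ {m} → Permutation′ m → ℕ
    F π = ascents (flatten π)
    Sₙ = permutations (suc n)
    per-π : ∀ π → sum (map (F ∘ insertAfter π) (allFin (suc (suc n)))) ≡ suc n * F π + suc (suc n)
    per-π π = trans (sum-map-allFin (F ∘ insertAfter π)) (∑-ascents-insertAfter π)
    count-term : length Sₙ * suc (suc n) ≡ suc (suc n) * suc n !
    count-term = trans (cong (_* suc (suc n)) (length-permutations (suc n))) (*-comm (suc n !) (suc (suc n)))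

closed-form-step : ∀ n T T′ F → T′ ≡ suc n * T + suc (suc n) * F → 2 * suc n * T ≡ F * (n * (suc n + 2)) →
  2 * suc (suc n) * T′ ≡ (suc (suc n) * F) * (suc n * (suc (suc n) + 2))
closed-form-step n T T′ F refl IH = begin
  2 * (2 + n) * ((1 + n) * T + (2 + n) * F)                     ≡⟨ expand n T F ⟩
  (2 + n) * (2 * (1 + n) * T) + 2 * (2 + n) * (2 + n) * F       ≡⟨ cong (λ z → (2 + n) * z + 2 * (2 + n) * (2 + n) * F) IH ⟩
  (2 + n) * (F * (n * (1 + n + 2))) + 2 * (2 + n) * (2 + n) * F ≡⟨ collect n F ⟩
  ((2 + n) * F) * ((1 + n) * (2 + n + 2))                        ∎
  where
    open ≡-Reasoning
    expand : ∀ n T F → 2 * (2 + n) * ((1 + n) * T + (2 + n) * F) ≡ (2 + n) * (2 * (1 + n) * T) + 2 * (2 + n) * (2 + n) * F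
    expand = solve-∀
    collect : ∀ n F → (2 + n) * (F * (n * (1 + n + 2))) + 2 * (2 + n) * (2 + n) * F ≡ ((2 + n) * F) * ((1 + n) * (2 + n + 2))
    collect = solve-∀

totalAscents-permutations : ∀ n → 2 * suc n * totalAscents (permutations (suc n)) ≡ suc n ! * (n * (suc n + 2))
totalAscents-permutations zero = refl
totalAscents-permutations (suc n) =
  closed-form-step n _ _ (suc n !) (totalAscents-recurrence n) (totalAscents-permutations n)

corollary2p4 : (n : ℕ) → n ≥ 1 → (L : List (Permutation′ n)) → EnumeratesSn n L →
    2 * n * totalAscents L ≡ (n !) * ((n ∸ 1) * (n + 2))
corollary2p4 (suc n) _ L L-enumerates = begin
  2 * suc n * totalAscents L                      ≡⟨ cong (2 * suc n *_) (sum-enumerations (ascents ∘ flatten) (cong ascents ∘ flatten-cong)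
                                                       L-enumerates (permutations-enumerates (suc n))) ⟩
  2 * suc n * totalAscents (permutations (suc n)) ≡⟨ totalAscents-permutations n ⟩
  suc n ! * (n * (suc n + 2))                     ∎
  where open ≡-Reasoning
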